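{- Let $a,b\in\mathbb{N}$ with $a+b$ even, and let $n$ be a positive integer. Then $$2n\ \Big|\ \sum_{k=0}^{n-1}\binom{n-1}{k}^a\binom{ -n-1}{k}^b\binom{2k}{k}(k+2)3^{n-1-k}.$$
   Context: $\binom{x}{k}=x(x-1)\cdots(x-k+1)/k!$ for any integer $x$ and $k\in\mathbb{N}$. -}

module Defs where

open import Data.Nat as ℕ using (ℕ; zero; suc)
open import Data.Nat.Base using (_!)
open import Data.Nat.Properties using (_!≢0)
open import Data.Integer using (ℤ; +_; _+_; _-_; _*_; _^_)
open import Data.Integer.DivMod using (_/ℕ_)

falling : ℤ → ℕ → ℤ
falling x zero    = + 1
falling x (suc k) = falling x k * (x - + k)

-- generalized binomial coefficient  binom x k = x(x-1)...(x-k+1)/k!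
-- (the division is exact; k! is nonzero)
binom : ℤ → ℕ → ℤ
binom x k = _/ℕ_ (falling x k) (k !) {{k !≢0}}

sumTo : ℕ → (ℕ → ℤ) → ℤ
sumTo zero    f = + 0
sumTo (suc m) f = sumTo m f + f m

module Submission where

-- Write c k = C(2k,k), K k = C(2k+1,k) and D k = 2(k+1)·K k, and let
-- w k = C(n-1,k)^a · C(-n-1,k)^b, so the sum is the Horner sum
--   S(N) = Σ_{k<N} w k · c k · (k+2) · 3^(N-1-k)   evaluated at N = n.
-- (1) Central binomial coefficients satisfy D 0 = 2 and
--     D(k+1) = 3·D k + c(k+1)·(k+3); hence for constant w the Horner sums are
--     exactly the D j, and in general  S(j+1) ≡ D j · w j (mod 2n)  as soon as
--     2n ∣ D k·(w k - w(k+1)) for every k.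
-- (2) That weighted congruence comes from Pascal's rule: for any integer x,
--     D k·(C(x,k) + C(x,k+1)) = 2(x+1)·K k·C(x,k), and 2n ∣ 2(x+1) for both
--     x = n-1 and x = -n-1.  So C(x,k+1) ≡ -C(x,k) "after scaling by D k",
--     which is a ring congruence; with a+b even the signs cancel in w.
-- (3) Finally S(n) ≡ D(n-1)·w(n-1) = 2n·K(n-1)·w(n-1) ≡ 0 (mod 2n).

open import Defs
open import Data.Nat using (ℕ; _∸_; _≤_)
open import Data.Nat.Divisibility using () renaming (_∣_ to _∣ℕ_)
open import Data.Integer using (ℤ; +_; -_; _+_; _-_; _*_; _^_)
open import Data.Integer.Divisibility using (_∣_)

open import Data.Nat as ℕ using (zero; suc; NonZero; z≤n; s≤s)
open import Data.Nat.Base using (_!)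
open import Data.Nat.Properties as ℕP using (_!≢0)
import Data.Nat.Divisibility as ℕD
open import Data.Integer using (-[1+_]; 0ℤ)
open import Data.Integer.DivMod using (_/ℕ_; _%ℕ_; a≡a%ℕn+[a/ℕn]*n; n%ℕd<d)
import Data.Integer.Properties as ℤP
open import Data.Integer.Divisibility.Signed
  using (divides; ∣-refl; ∣-reflexive; ∣m∣n⇒∣m+n; ∣m+n∣n⇒∣m; ∣m⇒∣-m;
         ∣n⇒∣m*n; ∣m⇒∣m*n; *-monoʳ-∣; ∣⇒∣ᵤ)
  renaming (_∣_ to _∣ₛ_)
open import Data.Integer.Tactic.RingSolver using (solve-∀)
open import Relation.Binary.PropositionalEquality
open import Relation.Nullary using (contradiction)

small-multiple≡0 : ∀ {r d} → r ℕ.< d → d ∣ℕ r → r ≡ 0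
small-multiple≡0 {zero}  r<d d∣r = refl
small-multiple≡0 {suc r} r<d d∣r = contradiction d∣r (ℕD.>⇒∤ r<d)

/ℕ-exact : ∀ x d .{{_ : NonZero d}} → + d ∣ₛ x → (x /ℕ d) * + d ≡ x
/ℕ-exact x d d∣x = sym (begin
  x                                 ≡⟨ a≡a%ℕn+[a/ℕn]*n x d ⟩
  + (x %ℕ d) + (x /ℕ d) * + d       ≡⟨ cong (λ r → + r + (x /ℕ d) * + d) remainder≡0 ⟩
  + 0 + (x /ℕ d) * + d              ≡⟨ ℤP.+-identityˡ _ ⟩
  (x /ℕ d) * + d                    ∎)
  where
  open ≡-Reasoning
  d∣remainder : + d ∣ₛ + (x %ℕ d)
  d∣remainder = ∣m+n∣n⇒∣m (subst (+ d ∣ₛ_) (a≡a%ℕn+[a/ℕn]*n x d) d∣x)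
                          (∣n⇒∣m*n (x /ℕ d) ∣-refl)
  remainder≡0 : x %ℕ d ≡ 0
  remainder≡0 = small-multiple≡0 (n%ℕd<d x d) (∣⇒∣ᵤ d∣remainder)

falling-upper : ∀ x k → falling (+ 1 + x) (suc k) ≡ (+ 1 + x) * falling x k
falling-upper x zero = ring x
  where
  ring : ∀ x → + 1 * ((+ 1 + x) - + 0) ≡ (+ 1 + x) * + 1
  ring = solve-∀
falling-upper x (suc k) = begin
  falling (+ 1 + x) (suc k) * ((+ 1 + x) - + suc k)   ≡⟨ cong (_* ((+ 1 + x) - + suc k)) (falling-upper x k) ⟩
  (+ 1 + x) * falling x k * ((+ 1 + x) - (+ 1 + + k)) ≡⟨ ring x (falling x k) (+ k) ⟩
  (+ 1 + x) * (falling x k * (x - + k))               ∎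
  where
  open ≡-Reasoning
  ring : ∀ x f k → (+ 1 + x) * f * ((+ 1 + x) - (+ 1 + k)) ≡ (+ 1 + x) * (f * (x - k))
  ring = solve-∀

falling-pascal : ∀ x k → falling (+ 1 + x) (suc k) ≡ falling x (suc k) + + suc k * falling x k
falling-pascal x k = trans (falling-upper x k) (ring x (falling x k) (+ k))
  where
  ring : ∀ x f k → (+ 1 + x) * f ≡ f * (x - k) + (+ 1 + k) * f
  ring = solve-∀

falling-zero : ∀ k → falling 0ℤ (suc k) ≡ 0ℤ
falling-zero zero    = refl
falling-zero (suc k) = cong (_* (0ℤ - + suc k)) (falling-zero k)

ℤ-induction : (P : ℤ → Set) → P 0ℤ → (∀ x → P x → P (+ 1 + x)) → (∀ x → P (+ 1 + x) → P x) →
              ∀ x → P x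
ℤ-induction P p₀ up down (+ zero)       = p₀
ℤ-induction P p₀ up down (+ suc m)      = up (+ m) (ℤ-induction P p₀ up down (+ m))
ℤ-induction P p₀ up down -[1+ zero ]    = down -[1+ 0 ] p₀
ℤ-induction P p₀ up down -[1+ suc m ]   = down -[1+ suc m ] (ℤ-induction P p₀ up down -[1+ m ])

-- k! divides x(x-1)…(x-k+1) for every integer x: induction on k, then on x via Pascal's rule.
factorial∣falling : ∀ k x → + (k !) ∣ₛ falling x k
factorial∣falling zero    x = ∣-refl
factorial∣falling (suc k) = ℤ-induction P base up down
  where
  P : ℤ → Set
  P x = + (suc k !) ∣ₛ falling x (suc k)
  base : P 0ℤ
  base = subst (+ (suc k !) ∣ₛ_) (sym (falling-zero k)) (divides 0ℤ refl)
  pascal-term : ∀ x → + (suc k !) ∣ₛ + suc k * falling x k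
  pascal-term x = subst (_∣ₛ + suc k * falling x k) (sym (ℤP.pos-* (suc k) (k !)))
                        (*-monoʳ-∣ (+ suc k) (factorial∣falling k x))
  up : ∀ x → P x → P (+ 1 + x)
  up x h = subst (+ (suc k !) ∣ₛ_) (sym (falling-pascal x k)) (∣m∣n⇒∣m+n h (pascal-term x))
  down : ∀ x → P (+ 1 + x) → P x
  down x h = ∣m+n∣n⇒∣m (subst (+ (suc k !) ∣ₛ_) (falling-pascal x k) h) (pascal-term x)

binom-falling : ∀ x k → binom x k * + (k !) ≡ falling x k
binom-falling x k = /ℕ-exact (falling x k) (k !) {{k !≢0}} (factorial∣falling k x)

cancel-! : ∀ k {u v} → u * + (k !) ≡ v * + (k !) → u ≡ v
cancel-! k = ℤP.*-cancelʳ-≡ _ _ (+ (k !)) {{k !≢0}}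

binom-suc-falling : ∀ x k → binom x (suc k) * + suc k * + (k !) ≡ falling x (suc k)
binom-suc-falling x k = begin
  binom x (suc k) * + suc k * + (k !)     ≡⟨ ℤP.*-assoc (binom x (suc k)) (+ suc k) (+ (k !)) ⟩
  binom x (suc k) * (+ suc k * + (k !))   ≡⟨ cong (binom x (suc k) *_) (ℤP.pos-* (suc k) (k !)) ⟨
  binom x (suc k) * + (suc k !)           ≡⟨ binom-falling x (suc k) ⟩
  falling x (suc k)                       ∎
  where open ≡-Reasoning

binom-absorption : ∀ x k → binom x (suc k) * + suc k ≡ binom x k * (x - + k)
binom-absorption x k = cancel-! k (begin
  binom x (suc k) * + suc k * + (k !)   ≡⟨ binom-suc-falling x k ⟩
  falling x k * (x - + k)               ≡⟨ cong (_* (x - + k)) (binom-falling x k) ⟨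
  binom x k * + (k !) * (x - + k)       ≡⟨ ring (binom x k) (+ (k !)) (x - + k) ⟩
  binom x k * (x - + k) * + (k !)       ∎)
  where
  open ≡-Reasoning
  ring : ∀ b f y → b * f * y ≡ b * y * f
  ring = solve-∀

binom-upper : ∀ x k → binom (+ 1 + x) (suc k) * + suc k ≡ (+ 1 + x) * binom x k
binom-upper x k = cancel-! k (begin
  binom (+ 1 + x) (suc k) * + suc k * + (k !)   ≡⟨ binom-suc-falling (+ 1 + x) k ⟩
  falling (+ 1 + x) (suc k)                     ≡⟨ falling-upper x k ⟩
  (+ 1 + x) * falling x k                       ≡⟨ cong ((+ 1 + x) *_) (binom-falling x k) ⟨
  (+ 1 + x) * (binom x k * + (k !))             ≡⟨ ℤP.*-assoc (+ 1 + x) (binom x k) (+ (k !)) ⟨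
  (+ 1 + x) * binom x k * + (k !)               ∎)
  where open ≡-Reasoning

binom-row : ∀ x k → binom (+ 1 + x) k * ((+ 1 + x) - + k) ≡ (+ 1 + x) * binom x k
binom-row x k = cancel-! k (begin
  binom (+ 1 + x) k * ((+ 1 + x) - + k) * + (k !)   ≡⟨ ring (binom (+ 1 + x) k) ((+ 1 + x) - + k) (+ (k !)) ⟩
  binom (+ 1 + x) k * + (k !) * ((+ 1 + x) - + k)   ≡⟨ cong (_* ((+ 1 + x) - + k)) (binom-falling (+ 1 + x) k) ⟩
  falling (+ 1 + x) (suc k)                         ≡⟨ falling-upper x k ⟩
  (+ 1 + x) * falling x k                           ≡⟨ cong ((+ 1 + x) *_) (binom-falling x k) ⟨
  (+ 1 + x) * (binom x k * + (k !))                 ≡⟨ ℤP.*-assoc (+ 1 + x) (binom x k) (+ (k !)) ⟨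
  (+ 1 + x) * binom x k * + (k !)                   ∎)
  where
  open ≡-Reasoning
  ring : ∀ b y f → b * y * f ≡ b * f * y
  ring = solve-∀

c : ℕ → ℤ
c k = binom (+ (2 ℕ.* k)) k

K : ℕ → ℤ
K k = binom (+ 1 + + (2 ℕ.* k)) k

D : ℕ → ℤ
D k = + 2 * (+ 1 + + k) * K k

K-c : ∀ k → K k * (+ 1 + + k) ≡ (+ 1 + + 2 * + k) * c k
K-c k = begin
  K k * (+ 1 + + k)                        ≡⟨ cong (K k *_) (ring (+ k)) ⟩
  K k * ((+ 1 + + 2 * + k) - + k)          ≡⟨ cong (λ t → K k * ((+ 1 + t) - + k)) (ℤP.pos-* 2 k) ⟨
  K k * ((+ 1 + + (2 ℕ.* k)) - + k)        ≡⟨ binom-row (+ (2 ℕ.* k)) k ⟩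
  (+ 1 + + (2 ℕ.* k)) * c k                ≡⟨ cong (λ t → (+ 1 + t) * c k) (ℤP.pos-* 2 k) ⟩
  (+ 1 + + 2 * + k) * c k                  ∎
  where
  open ≡-Reasoning
  ring : ∀ j → + 1 + j ≡ (+ 1 + + 2 * j) - j
  ring = solve-∀

c-K : ∀ k → c (suc k) ≡ + 2 * K k
c-K k = ℤP.*-cancelʳ-≡ _ _ (+ suc k) (begin
  c (suc k) * + suc k                                       ≡⟨ cong (λ t → binom t (suc k) * + suc k) two-suc ⟩
  binom (+ 1 + (+ 1 + + (2 ℕ.* k))) (suc k) * + suc k       ≡⟨ binom-upper (+ 1 + + (2 ℕ.* k)) k ⟩
  (+ 1 + (+ 1 + + (2 ℕ.* k))) * K k                         ≡⟨ cong (λ t → (+ 1 + (+ 1 + t)) * K k) (ℤP.pos-* 2 k) ⟩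
  (+ 1 + (+ 1 + + 2 * + k)) * K k                           ≡⟨ ring (+ k) (K k) ⟩
  + 2 * K k * (+ 1 + + k)                                   ∎)
  where
  open ≡-Reasoning
  two-suc : + (2 ℕ.* suc k) ≡ + 1 + (+ 1 + + (2 ℕ.* k))
  two-suc = cong +_ (ℕP.*-suc 2 k)
  ring : ∀ j y → (+ 1 + (+ 1 + + 2 * j)) * y ≡ + 2 * y * (+ 1 + j)
  ring = solve-∀

-- The weights obey the recurrence D(k+1) = 3·D k + c(k+1)·(k+3), matching one Horner step.
D-recurrence : ∀ k → D (suc k) ≡ + 3 * D k + c (suc k) * (+ suc k + + 2)
D-recurrence k = combine (+ suc k) (K k) (K (suc k)) (c (suc k)) (c-K k) (K-c (suc k))
  where
  open ≡-Reasoning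
  combine : ∀ s K₀ K₁ c₁ → c₁ ≡ + 2 * K₀ → K₁ * (+ 1 + s) ≡ (+ 1 + + 2 * s) * c₁ →
            + 2 * (+ 1 + s) * K₁ ≡ + 3 * (+ 2 * s * K₀) + c₁ * (s + + 2)
  combine s K₀ K₁ .(+ 2 * K₀) refl K₁-step = begin
    + 2 * (+ 1 + s) * K₁                       ≡⟨ ring₁ s K₁ ⟩
    + 2 * (K₁ * (+ 1 + s))                     ≡⟨ cong (+ 2 *_) K₁-step ⟩
    + 2 * ((+ 1 + + 2 * s) * (+ 2 * K₀))       ≡⟨ ring₂ s K₀ ⟩
    + 3 * (+ 2 * s * K₀) + + 2 * K₀ * (s + + 2) ∎
    where
    ring₁ : ∀ s y → + 2 * (+ 1 + s) * y ≡ + 2 * (y * (+ 1 + s))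
    ring₁ = solve-∀
    ring₂ : ∀ s y → + 2 * ((+ 1 + + 2 * s) * (+ 2 * y)) ≡ + 3 * (+ 2 * s * y) + + 2 * y * (s + + 2)
    ring₂ = solve-∀

D-pascal : ∀ x k → D k * (binom x k + binom x (suc k)) ≡ + 2 * (+ 1 + x) * (K k * binom x k)
D-pascal x k = begin
  D k * (B₀ + B₁)                                                      ≡⟨ ring₁ (K k) B₀ B₁ (+ k) ⟩
  + 2 * K k * ((+ 1 + + k) * B₀) + + 2 * K k * (B₁ * + suc k)          ≡⟨ cong (λ t → + 2 * K k * ((+ 1 + + k) * B₀) + + 2 * K k * t) (binom-absorption x k) ⟩
  + 2 * K k * ((+ 1 + + k) * B₀) + + 2 * K k * (B₀ * (x - + k))        ≡⟨ ring₂ (K k) B₀ x (+ k) ⟩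
  + 2 * (+ 1 + x) * (K k * B₀)                                         ∎
  where
  open ≡-Reasoning
  B₀ = binom x k
  B₁ = binom x (suc k)
  ring₁ : ∀ y b₀ b₁ j → + 2 * (+ 1 + j) * y * (b₀ + b₁) ≡ + 2 * y * ((+ 1 + j) * b₀) + + 2 * y * (b₁ * (+ 1 + j))
  ring₁ = solve-∀
  ring₂ : ∀ y b₀ x j → + 2 * y * ((+ 1 + j) * b₀) + + 2 * y * (b₀ * (x - j)) ≡ + 2 * (+ 1 + x) * (y * b₀)
  ring₂ = solve-∀

record ScaledCong (M D x y : ℤ) : Set where
  constructor scaledCong
  field divides-scaled : M ∣ₛ D * (x - y)

open ScaledCong

scaledCong-* : ∀ {M D x p y q} → ScaledCong M D x p → ScaledCong M D y q →
               ScaledCong M D (x * y) (p * q)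
scaledCong-* {M} {D} {x} {p} {y} {q} (scaledCong x≈p) (scaledCong y≈q) = scaledCong
  (subst (M ∣ₛ_) (sym (ring D x p y q)) (∣m∣n⇒∣m+n (∣n⇒∣m*n x y≈q) (∣n⇒∣m*n q x≈p)))
  where
  ring : ∀ D x p y q → D * (x * y - p * q) ≡ x * (D * (y - q)) + q * (D * (x - p))
  ring = solve-∀

scaledCong-^ : ∀ {M D x p} → ScaledCong M D x p → ∀ a → ScaledCong M D (x ^ a) (p ^ a)
scaledCong-^ {M} {D} x≈p zero    = scaledCong (subst (M ∣ₛ_) (sym (ℤP.*-zeroʳ D)) (divides 0ℤ refl))
scaledCong-^         x≈p (suc a) = scaledCong-* x≈p (scaledCong-^ x≈p a)

-- 2(x+1) ∣ D k·(C(x,k) + C(x,k+1)), so C(x,k) is congruent to −C(x,k+1) after scaling by D k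
-- modulo any divisor of 2(x+1).
binom-scaledCong : ∀ M x k → M ∣ₛ + 2 * (+ 1 + x) →
                   ScaledCong M (D k) (binom x k) (- binom x (suc k))
binom-scaledCong M x k M∣2[1+x] =
  scaledCong (subst (M ∣ₛ_) (sym eq) (∣m⇒∣m*n (K k * binom x k) M∣2[1+x]))
  where
  eq : D k * (binom x k - - binom x (suc k)) ≡ + 2 * (+ 1 + x) * (K k * binom x k)
  eq = trans (cong (λ t → D k * (binom x k + t)) (ℤP.neg-involutive (binom x (suc k))))
             (D-pascal x k)

neg-^ : ∀ u a → (- u) ^ a ≡ (- + 1) ^ a * u ^ a
neg-^ u zero    = refl
neg-^ u (suc a) = trans (cong (- u *_) (neg-^ u a)) (ring u ((- + 1) ^ a) (u ^ a))
  where
  ring : ∀ u s v → - u * (s * v) ≡ - + 1 * s * (u * v)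
  ring = solve-∀

neg-one-^-even : ∀ t → (- + 1) ^ (t ℕ.* 2) ≡ + 1
neg-one-^-even t = begin
  (- + 1) ^ (t ℕ.* 2)      ≡⟨ cong ((- + 1) ^_) (ℕP.*-comm t 2) ⟩
  (- + 1) ^ (2 ℕ.* t)      ≡⟨ ℤP.^-*-assoc (- + 1) 2 t ⟨
  ((- + 1) ^ 2) ^ t        ≡⟨ ℤP.^-zeroˡ t ⟩
  + 1                      ∎
  where open ≡-Reasoning

even-signs : ∀ u v a b t → a ℕ.+ b ≡ t ℕ.* 2 → (- u) ^ a * (- v) ^ b ≡ u ^ a * v ^ b
even-signs u v a b t a+b≡2t = begin
  (- u) ^ a * (- v) ^ b                              ≡⟨ cong₂ _*_ (neg-^ u a) (neg-^ v b) ⟩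
  (- + 1) ^ a * u ^ a * ((- + 1) ^ b * v ^ b)        ≡⟨ ring ((- + 1) ^ a) ((- + 1) ^ b) (u ^ a) (v ^ b) ⟩
  ((- + 1) ^ a * (- + 1) ^ b) * (u ^ a * v ^ b)      ≡⟨ cong (_* (u ^ a * v ^ b)) sign≡1 ⟩
  + 1 * (u ^ a * v ^ b)                              ≡⟨ ℤP.*-identityˡ _ ⟩
  u ^ a * v ^ b                                      ∎
  where
  open ≡-Reasoning
  ring : ∀ s s′ x y → s * x * (s′ * y) ≡ (s * s′) * (x * y)
  ring = solve-∀
  sign≡1 : (- + 1) ^ a * (- + 1) ^ b ≡ + 1
  sign≡1 = trans (sym (ℤP.^-distribˡ-+-* (- + 1) a b))
                 (trans (cong ((- + 1) ^_) a+b≡2t) (neg-one-^-even t))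

horner : ℤ → (ℕ → ℤ) → ℕ → ℤ
horner r g N = sumTo N (λ k → g k * r ^ (N ∸ 1 ∸ k))

sumTo-cong : ∀ N {f h : ℕ → ℤ} → (∀ k → k ℕ.< N → f k ≡ h k) → sumTo N f ≡ sumTo N h
sumTo-cong zero    f≡h = refl
sumTo-cong (suc N) f≡h =
  cong₂ _+_ (sumTo-cong N (λ k k<N → f≡h k (ℕP.m<n⇒m<1+n k<N))) (f≡h N (ℕP.n<1+n N))

sumTo-*ˡ : ∀ r N (f : ℕ → ℤ) → sumTo N (λ k → r * f k) ≡ r * sumTo N f
sumTo-*ˡ r zero    f = sym (ℤP.*-zeroʳ r)
sumTo-*ˡ r (suc N) f =
  trans (cong (_+ r * f N) (sumTo-*ˡ r N f)) (sym (ℤP.*-distribˡ-+ r (sumTo N f) (f N)))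

∸-pred : ∀ {k N} → k ℕ.< N → N ∸ k ≡ suc (N ∸ 1 ∸ k)
∸-pred {k} {suc N} (s≤s k≤N) = ℕP.+-∸-assoc 1 k≤N

horner-step : ∀ r g N → horner r g (suc N) ≡ r * horner r g N + g N
horner-step r g N = cong₂ _+_ earlier-terms last-term
  where
  raise : ∀ k → k ℕ.< N → g k * r ^ (N ∸ k) ≡ r * (g k * r ^ (N ∸ 1 ∸ k))
  raise k k<N = trans (cong (λ e → g k * r ^ e) (∸-pred k<N)) (ring (g k) r (r ^ (N ∸ 1 ∸ k)))
    where
    ring : ∀ y r z → y * (r * z) ≡ r * (y * z)
    ring = solve-∀
  earlier-terms : sumTo N (λ k → g k * r ^ (N ∸ k)) ≡ r * horner r g N
  earlier-terms = trans (sumTo-cong N raise) (sumTo-*ˡ r N (λ k → g k * r ^ (N ∸ 1 ∸ k)))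
  last-term : g N * r ^ (N ∸ N) ≡ g N
  last-term = trans (cong (λ e → g N * r ^ e) (ℕP.n∸n≡0 N)) (ℤP.*-identityʳ (g N))

-- For constant w this
-- is the identity Σ_{k≤j} C(2k,k)(k+2)3^(j-k) = D j, which is just the recurrence for D.
central-horner : ∀ M (w : ℕ → ℤ) → (∀ k → ScaledCong M (D k) (w k) (w (suc k))) → ∀ j →
                 M ∣ₛ horner (+ 3) (λ k → w k * c k * (+ k + + 2)) (suc j) - D j * w j
central-horner M w w-step zero = subst (M ∣ₛ_) (sym (ring (w 0))) (divides 0ℤ refl)
  where
  ring : ∀ y → + 0 + y * + 1 * + 2 * + 1 - + 2 * y ≡ + 0
  ring = solve-∀
central-horner M w w-step (suc j) =
  subst (M ∣ₛ_) (sym split)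
        (∣m∣n⇒∣m+n (∣n⇒∣m*n (+ 3) (central-horner M w w-step j))
                   (∣n⇒∣m*n (+ 3) (divides-scaled (w-step j))))
  where
  open ≡-Reasoning
  g : ℕ → ℤ
  g k = w k * c k * (+ k + + 2)
  ring : ∀ h d y y′ c s → (+ 3 * h + y′ * c * s) - (+ 3 * d + c * s) * y′ ≡
                          + 3 * (h - d * y) + + 3 * (d * (y - y′))
  ring = solve-∀
  split : horner (+ 3) g (suc (suc j)) - D (suc j) * w (suc j) ≡
          + 3 * (horner (+ 3) g (suc j) - D j * w j) + + 3 * (D j * (w j - w (suc j)))
  split = begin
    horner (+ 3) g (suc (suc j)) - D (suc j) * w (suc j)
      ≡⟨ cong₂ (λ h d → h - d * w (suc j)) (horner-step (+ 3) g (suc j)) (D-recurrence j) ⟩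
    (+ 3 * horner (+ 3) g (suc j) + g (suc j)) - (+ 3 * D j + c (suc j) * (+ suc j + + 2)) * w (suc j)
      ≡⟨ ring (horner (+ 3) g (suc j)) (D j) (w j) (w (suc j)) (c (suc j)) (+ suc j + + 2) ⟩
    + 3 * (horner (+ 3) g (suc j) - D j * w j) + + 3 * (D j * (w j - w (suc j))) ∎

-- With n = m+1, both C(m,k) and C(-n-1,k) flip sign from k to k+1 after scaling by D k
-- modulo 2n (as 2n divides 2(x+1) for x = m and x = -n-1); for a+b even the weights
-- w k = C(m,k)^a C(-n-1,k)^b are therefore scaled-congruent to their successors, so the sum is
-- congruent to D m·w m = 2n·K m·w m ≡ 0 (mod 2n).
lemma3p4 : (a b n : ℕ) → 2 ∣ℕ (a Data.Nat.+ b) → 1 ≤ n →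
    + (2 Data.Nat.* n) ∣ sumTo n (λ k →
      binom (+ (n ∸ 1)) k ^ a * binom (- (+ n) - + 1) k ^ b
      * binom (+ (2 Data.Nat.* k)) k * (+ k + + 2) * ((+ 3) ^ (n ∸ 1 ∸ k)))
lemma3p4 a b (suc m) (ℕD.divides t a+b≡2t) (s≤s z≤n) =
  ∣⇒∣ᵤ (∣m+n∣n⇒∣m {M} {sum} (central-horner M w w-step m) (∣m⇒∣-m M∣Dw))
  where
  M = + (2 ℕ.* suc m)
  x₁ = + m
  x₂ = - (+ suc m) - + 1
  w : ℕ → ℤ
  w k = binom x₁ k ^ a * binom x₂ k ^ b
  sum : ℤ
  sum = horner (+ 3) (λ k → w k * c k * (+ k + + 2)) (suc m)
  M∣x₁ : M ∣ₛ + 2 * (+ 1 + x₁)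
  M∣x₁ = ∣-reflexive (ℤP.pos-* 2 (suc m))
  M∣x₂ : M ∣ₛ + 2 * (+ 1 + x₂)
  M∣x₂ = subst (M ∣ₛ_) (trans (cong -_ (ℤP.pos-* 2 (suc m))) (ring (+ suc m))) (∣m⇒∣-m ∣-refl)
    where
    ring : ∀ n → - (+ 2 * n) ≡ + 2 * (+ 1 + (- n - + 1))
    ring = solve-∀
  w-step : ∀ k → ScaledCong M (D k) (w k) (w (suc k))
  w-step k = subst (ScaledCong M (D k) (w k))
                   (even-signs (binom x₁ (suc k)) (binom x₂ (suc k)) a b t a+b≡2t)
                   (scaledCong-* (scaledCong-^ (binom-scaledCong M x₁ k M∣x₁) a)
                                 (scaledCong-^ (binom-scaledCong M x₂ k M∣x₂) b))
  M∣Dw : M ∣ₛ D m * w m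
  M∣Dw = ∣m⇒∣m*n (w m) (∣m⇒∣m*n (K m) M∣x₁)
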